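{- Let $\Lambda$ be a ring with identity and $A,B,C,D\in\Lambda$. For every $r\ge0$, $(1-G(w)Az)G_{r+1}^*=G(w)(Az)G_r^*$ in $\Lambda[[z]]$.
   Context: A walk of length $l\ge0$ is an $(l+1)$-tuple $\alpha=(\alpha_0,\dots,\alpha_l)$ of integers with each $\alpha_i-\alpha_{i-1}\in\{ -1,0,1\}$; it is a walk from $\alpha_0$ to $\alpha_l$. Weights: $w(\alpha)=1$ if $l=0$, else $w(\alpha)=U_1\cdots U_l$ with $U_i=A,B,C$ according as $\alpha_i-\alpha_{i-1}=-1,0,1$; $w^*(\alpha)$ is defined the same way except that $U_i=D$ (instead of $B$) whenever $\alpha_{i-1}=\alpha_i=0$. A walk is standard if $\alpha_i\ge\alpha_l$ for all $i$. $G(w)=\sum w(\alpha)z^{l(\alpha)}$ over all standard walks from $0$ to $0$. For $r\ge0$, $G_r^*=\sum\binom{\alpha_0}{r}w^*(\alpha)z^{l(\alpha)}$, the sum over all standard walks finishing at $0$. -}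

module Defs where

open import Level using (Level)
open import Algebra.Bundles using (Ring)
open import Data.Nat using (ℕ; zero; suc; _∸_) renaming (_*_ to _*ℕ_)
open import Data.Nat.Combinatorics using () renaming (_C_ to binom)
open import Data.Integer as ℤ using (ℤ; +_; _≤?_)
open import Data.List using (List; []; _∷_; foldr; map; upTo; concatMap; last)
open import Data.List.Relation.Unary.All using (All)
open import Data.List.Relation.Unary.All as All using (all?)
open import Data.Bool using (Bool; true; false; if_then_else_; _∧_)
open import Relation.Nullary.Decidable using (⌊_⌋)

data Step : Set where
  down flat up : Step

δ : Step → ℤ
δ down = ℤ.-[1+ 0 ]
δ flat = + 0
δ up   = + 1

allSteps : ℕ → List (List Step)
allSteps zero    = [] ∷ []
allSteps (suc l) = concatMap (λ ss → (down ∷ ss) ∷ (flat ∷ ss) ∷ (up ∷ ss) ∷ []) (allSteps l)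

-- A walk α = (α_0, ..., α_l) is given by its start α_0 and its list of steps.
-- positions a ss = (α_0, α_1, ..., α_l)
positions : ℤ → List Step → List ℤ
positions a []       = a ∷ []
positions a (s ∷ ss) = a ∷ positions (a ℤ.+ δ s) ss

endpoint : ℤ → List Step → ℤ
endpoint a []       = a
endpoint a (s ∷ ss) = endpoint (a ℤ.+ δ s) ss

isZero : ℤ → Bool
isZero (+ zero) = true
isZero _        = false

standard : ℤ → List Step → Bool
standard a ss = ⌊ all? (λ x → endpoint a ss ≤? x) (positions a ss) ⌋

stdTo0 : ℤ → List Step → Bool
stdTo0 a ss = standard a ss ∧ isZero (endpoint a ss)

-- candidate starting points of a walk of length l finishing at 0: α_0 ∈ [-l, l]
-- (any walk of length l finishing at 0 has |α_0| ≤ l)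
starts : ℕ → List ℤ
starts l = map (λ k → + k ℤ.- + l) (upTo (suc (2 *ℕ l)))

module Walks {c ℓ : Level} (Λ : Ring c ℓ) (A B C D : Ring.Carrier Λ) where
  open Ring Λ

  -- power series in Λ[[z]], as coefficient sequences
  PS : Set c
  PS = ℕ → Carrier

  Σ : List Carrier → Carrier
  Σ = foldr _+_ 0#

  _·_ : ℕ → Carrier → Carrier
  zero  · x = 0#
  suc n · x = x + n · x

  U : Step → Carrier
  U down = A
  U flat = B
  U up   = C

  w : List Step → Carrier
  w []       = 1#
  w (s ∷ ss) = U s * w ss

  -- U* for the weight w*: D instead of B when α_{i-1} = α_i = 0
  U* : ℤ → Step → Carrier
  U* a flat = if isZero a then D else B
  U* a s    = U s

  w* : ℤ → List Step → Carrier
  w* a []       = 1#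
  w* a (s ∷ ss) = U* a s * w* (a ℤ.+ δ s) ss

  G : PS
  G l = Σ (map (λ ss → if stdTo0 (+ 0) ss then w ss else 0#) (allSteps l))

  -- binom(α_0, r) for α_0 ≥ 0 (only used for standard walks finishing at 0, where α_0 ≥ 0)
  binomℤ : ℤ → ℕ → ℕ
  binomℤ (+ n)      r = binom n r
  binomℤ ℤ.-[1+ n ] r = 0

  G* : ℕ → PS
  G* r l = Σ (concatMap (λ a → map (λ ss → if stdTo0 a ss then binomℤ a r · w* a ss else 0#)
                                 (allSteps l)) (starts l))

  const : Carrier → PS
  const x zero    = x
  const x (suc n) = 0#

  Z : PS
  Z 1 = 1#
  Z _ = 0#

  _⊛_ : PS → PS → PS
  (f ⊛ g) n = Σ (map (λ i → f i * g (n ∸ i)) (upTo (suc n)))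

  _⊝_ : PS → PS → PS
  (f ⊝ g) n = f n - g n

  _≋_ : PS → PS → Set ℓ
  f ≋ g = ∀ n → f n ≈ g n

-- Let T h be the generating function of standard walks from height h to 0, for the weight w or w*.
-- Away from 0 the two weights agree, so both families satisfy the first-step equations
-- T (h+1) = z (A T h + B T (h+1) + C T (h+2)) with T (h+1) of order ≥ 1. Cutting a walk from h+1
-- at its first visit to h gives T (h+1) = X T h with X = z G A. This is derived from the
-- first-step equations alone, by strong induction on the length, together with the first-step
-- equation of G in the form G A = A + B X + C X². Finally G*_r = Σ_h (h choose r) T* h, and
-- Pascal's rule turns T* (h+1) = X T* h into G*_{r+1} = X G*_{r+1} + X G*_r.

module Submission where

open import Level using (Level; _⊔_)
open import Algebra.Bundles using (Ring)
open import Data.Bool using (true; false; if_then_else_; _∧_)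
open import Data.Bool.Properties using (∧-zeroʳ)
open import Data.Integer as ℤ using (ℤ; -[1+_]) renaming (+_ to pos)
import Data.Integer.Properties as ℤ
open import Data.List using (List; []; _∷_; map; upTo; concatMap; _++_)
open import Data.List.Properties using (map-∘; map-upTo; map-applyUpTo; map-concatMap)
open import Data.List.Membership.Propositional using (_∈_)
open import Data.List.Membership.Propositional.Properties using (∈-upTo⁻)
open import Data.List.Relation.Unary.Any using (here; there)
open import Data.List.Relation.Unary.All using (all?)
open import Data.Nat as ℕ using (ℕ; zero; suc; _∸_; _≤_; _<_; s≤s)
import Data.Nat.Properties as ℕ
open import Data.Nat.Combinatorics using (nCk+nC[k+1]≡[n+1]C[k+1]) renaming (_C_ to binom)
open import Data.Nat.Induction using (<-rec)
open import Function using (_∘_)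
open import Relation.Binary.PropositionalEquality as ≡ using (_≡_)
open import Relation.Nullary.Decidable using (⌊_⌋; isYes≗does)

open import Defs

standard-∷ : ∀ a s ss →
  standard a (s ∷ ss) ≡ ⌊ endpoint (a ℤ.+ δ s) ss ℤ.≤? a ⌋ ∧ standard (a ℤ.+ δ s) ss
standard-∷ a s ss =
  ≡.trans (isYes≗does (all? P (positions a (s ∷ ss))))
          (≡.cong₂ _∧_ (≡.sym (isYes≗does (P a)))
                       (≡.sym (isYes≗does (all? P (positions (a ℤ.+ δ s) ss)))))
  where P = endpoint (a ℤ.+ δ s) ss ℤ.≤?_

stdTo0-∷ : ∀ h s ss → stdTo0 (pos h) (s ∷ ss) ≡ stdTo0 (pos h ℤ.+ δ s) ss
stdTo0-∷ h s ss rewrite standard-∷ (pos h) s ss with endpoint (pos h ℤ.+ δ s) ss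
... | pos zero    = ≡.refl
... | pos (suc _) = ≡.trans (∧-zeroʳ _) (≡.sym (∧-zeroʳ _))
... | -[1+ _ ]    = ≡.trans (∧-zeroʳ _) (≡.sym (∧-zeroʳ _))

stdTo0-negative : ∀ k ss → stdTo0 -[1+ k ] ss ≡ false
stdTo0-negative k []       = ∧-zeroʳ _
stdTo0-negative k (s ∷ ss) rewrite standard-∷ -[1+ k ] s ss with endpoint (-[1+ k ] ℤ.+ δ s) ss
... | pos _    = ≡.refl
... | -[1+ _ ] = ∧-zeroʳ _

stdTo0-suc-[] : ∀ h → stdTo0 (pos (suc h)) [] ≡ false
stdTo0-suc-[] h = ∧-zeroʳ (standard (pos (suc h)) [])

pos-pos-negative : ∀ {i l} → i < l → pos i ℤ.- pos l ≡ -[1+ l ∸ suc i ]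
pos-pos-negative {i} {l} i<l =
  ≡.trans (ℤ.m-n≡m⊖n i l) (≡.trans (ℤ.⊖-< i<l) (≡.cong (ℤ.-_ ∘ pos) (ℕ.+-∸-assoc 1 i<l)))

pos[m+n]-pos-m : ∀ m n → pos (m ℕ.+ n) ℤ.- pos m ≡ pos n
pos[m+n]-pos-m m n =
  ≡.trans (ℤ.m-n≡m⊖n (m ℕ.+ n) m) (≡.trans (ℤ.⊖-≥ (ℕ.m≤m+n m n)) (≡.cong pos (ℕ.m+n∸m≡n m n)))

module WalkSeries {c ℓ : Level} (Λ : Ring c ℓ) (A B C D : Ring.Carrier Λ) where
  open Ring Λ hiding (zero)
  open Walks Λ A B C D
  open import Algebra.Properties.Ring Λ using (-‿distribˡ-*; -0#≈0#; -‿+-comm)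
  open import Algebra.Properties.Semiring.Mult semiring using (_×_; ×-congʳ; ×-homo-+; ×-comm-*)
  open import Algebra.Properties.CommutativeMonoid.Mult +-commutativeMonoid using (×-distrib-+)
  open import Algebra.Properties.CommutativeSemigroup +-commutativeSemigroup
    using () renaming (interchange to +-interchange)
  open import Relation.Binary.Reasoning.Setoid setoid

  x≈0⇒y*x≈0 : ∀ {x y} → x ≈ 0# → y * x ≈ 0#
  x≈0⇒y*x≈0 {y = y} x≈0 = trans (*-congˡ x≈0) (zeroʳ y)

  ×-zeroʳ : ∀ k → k × 0# ≈ 0#
  ×-zeroʳ zero    = refl
  ×-zeroʳ (suc k) = trans (+-identityˡ _) (×-zeroʳ k)

  ·≡× : ∀ k x → k · x ≡ k × x
  ·≡× zero    x = ≡.refl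
  ·≡× (suc k) x = ≡.cong (x +_) (·≡× k x)

  ∑ : {X : Set} → List X → (X → Carrier) → Carrier
  ∑ xs f = Σ (map f xs)

  syntax ∑ xs (λ x → e) = ∑[ x ← xs ] e

  module _ {X : Set} where

    ∑-cong-∈ : ∀ xs {f g : X → Carrier} → (∀ {x} → x ∈ xs → f x ≈ g x) → ∑ xs f ≈ ∑ xs g
    ∑-cong-∈ []       f≈g = refl
    ∑-cong-∈ (x ∷ xs) f≈g = +-cong (f≈g (here ≡.refl)) (∑-cong-∈ xs (f≈g ∘ there))

    ∑-cong : ∀ xs {f g : X → Carrier} → (∀ x → f x ≈ g x) → ∑ xs f ≈ ∑ xs g
    ∑-cong xs f≈g = ∑-cong-∈ xs (λ {x} _ → f≈g x)

    ∑-zero : ∀ xs {f : X → Carrier} → (∀ {x} → x ∈ xs → f x ≈ 0#) → ∑ xs f ≈ 0#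
    ∑-zero []       f≈0 = refl
    ∑-zero (x ∷ xs) f≈0 =
      trans (+-cong (f≈0 (here ≡.refl)) (∑-zero xs (f≈0 ∘ there))) (+-identityˡ 0#)

    ∑-+ : ∀ xs (f g : X → Carrier) → ∑[ x ← xs ] (f x + g x) ≈ ∑ xs f + ∑ xs g
    ∑-+ []       f g = sym (+-identityˡ 0#)
    ∑-+ (x ∷ xs) f g = trans (+-congˡ (∑-+ xs f g)) (+-interchange _ _ _ _)

    ∑-*ˡ : ∀ xs a (f : X → Carrier) → ∑[ x ← xs ] (a * f x) ≈ a * ∑ xs f
    ∑-*ˡ []       a f = sym (zeroʳ a)
    ∑-*ˡ (x ∷ xs) a f = trans (+-congˡ (∑-*ˡ xs a f)) (sym (distribˡ a _ _))

    ∑-*ʳ : ∀ xs a (f : X → Carrier) → ∑[ x ← xs ] (f x * a) ≈ ∑ xs f * a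
    ∑-*ʳ []       a f = sym (zeroˡ a)
    ∑-*ʳ (x ∷ xs) a f = trans (+-congˡ (∑-*ʳ xs a f)) (sym (distribʳ a _ _))

    ∑-neg : ∀ xs (f : X → Carrier) → ∑[ x ← xs ] (- f x) ≈ - ∑ xs f
    ∑-neg []       f = sym -0#≈0#
    ∑-neg (x ∷ xs) f = trans (+-congˡ (∑-neg xs f)) (-‿+-comm _ _)

    ∑-× : ∀ xs k (f : X → Carrier) → ∑[ x ← xs ] (k × f x) ≈ k × ∑ xs f
    ∑-× []       k f = sym (×-zeroʳ k)
    ∑-× (x ∷ xs) k f = trans (+-congˡ (∑-× xs k f)) (sym (×-distrib-+ _ _ k))

  ∑-comm : ∀ {X Y : Set} xs ys (f : X → Y → Carrier) →
           ∑[ x ← xs ] ∑[ y ← ys ] f x y ≈ ∑[ y ← ys ] ∑[ x ← xs ] f x y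
  ∑-comm []       ys f = sym (∑-zero ys (λ _ → refl))
  ∑-comm (x ∷ xs) ys f = trans (+-congˡ (∑-comm xs ys f)) (sym (∑-+ ys (f x) _))

  Σ-++ : ∀ xs ys → Σ (xs ++ ys) ≈ Σ xs + Σ ys
  Σ-++ []       ys = sym (+-identityˡ _)
  Σ-++ (x ∷ xs) ys = trans (+-congˡ (Σ-++ xs ys)) (sym (+-assoc _ _ _))

  Σ-concatMap : ∀ {X : Set} xs (g : X → List Carrier) → Σ (concatMap g xs) ≈ ∑[ x ← xs ] Σ (g x)
  Σ-concatMap []       g = refl
  Σ-concatMap (x ∷ xs) g = trans (Σ-++ (g x) (concatMap g xs)) (+-congˡ (Σ-concatMap xs g))

  ∑-upTo-suc : ∀ n (f : ℕ → Carrier) → ∑ (upTo (suc n)) f ≡ f 0 + ∑ (upTo n) (f ∘ suc)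
  ∑-upTo-suc n f =
    ≡.cong (λ xs → f 0 + Σ xs) (≡.trans (map-applyUpTo suc f n) (≡.sym (map-upTo (f ∘ suc) n)))

  ∑-upTo-+ : ∀ m n (f : ℕ → Carrier) →
             ∑ (upTo (m ℕ.+ n)) f ≈ ∑ (upTo m) f + ∑[ i ← upTo n ] f (m ℕ.+ i)
  ∑-upTo-+ zero    n f = sym (+-identityˡ _)
  ∑-upTo-+ (suc m) n f = begin
    ∑ (upTo (suc m ℕ.+ n)) f                  ≡⟨ ∑-upTo-suc (m ℕ.+ n) f ⟩
    f 0 + ∑ (upTo (m ℕ.+ n)) (f ∘ suc)         ≈⟨ +-congˡ (∑-upTo-+ m n (f ∘ suc)) ⟩
    f 0 + (∑ (upTo m) (f ∘ suc) + tail)        ≈⟨ sym (+-assoc _ _ _) ⟩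
    (f 0 + ∑ (upTo m) (f ∘ suc)) + tail        ≡⟨ ≡.cong (_+ tail) (≡.sym (∑-upTo-suc m f)) ⟩
    ∑ (upTo (suc m)) f + tail                  ∎
    where
    tail : Carrier
    tail = ∑[ i ← upTo n ] f (suc m ℕ.+ i)

  ∑-upTo-extend : ∀ {m n} (f : ℕ → Carrier) → m ≤ n → (∀ i → f (m ℕ.+ i) ≈ 0#) →
                  ∑ (upTo m) f ≈ ∑ (upTo n) f
  ∑-upTo-extend {m} {n} f m≤n tail≈0 = begin
    ∑ (upTo m) f
      ≈⟨ sym (+-identityʳ _) ⟩
    ∑ (upTo m) f + 0#
      ≈⟨ +-congˡ (sym (∑-zero (upTo (n ∸ m)) λ {i} _ → tail≈0 i)) ⟩
    ∑ (upTo m) f + ∑[ i ← upTo (n ∸ m) ] f (m ℕ.+ i)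
      ≈⟨ sym (∑-upTo-+ m (n ∸ m) f) ⟩
    ∑ (upTo (m ℕ.+ (n ∸ m))) f
      ≡⟨ ≡.cong (λ k → ∑ (upTo k) f) (ℕ.m+[n∸m]≡n m≤n) ⟩
    ∑ (upTo n) f ∎

  -- Power series

  shift : PS → PS
  shift f zero    = 0#
  shift f (suc n) = f n

  ⊛-zero : ∀ f g → (f ⊛ g) 0 ≈ f 0 * g 0
  ⊛-zero f g = +-identityʳ _

  ⊛-suc : ∀ f g n → (f ⊛ g) (suc n) ≡ f 0 * g (suc n) + ((f ∘ suc) ⊛ g) n
  ⊛-suc f g n = ∑-upTo-suc (suc n) (λ i → f i * g (suc n ∸ i))

  ⊛-cong-≤ : ∀ m {f f′ g g′} → (∀ {j} → j ≤ m → f j ≈ f′ j) → (∀ {j} → j ≤ m → g j ≈ g′ j) →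
             (f ⊛ g) m ≈ (f′ ⊛ g′) m
  ⊛-cong-≤ m f≈f′ g≈g′ = ∑-cong-∈ (upTo (suc m))
    (λ {i} i∈ → *-cong (f≈f′ (ℕ.≤-pred (∈-upTo⁻ i∈))) (g≈g′ (ℕ.m∸n≤m m i)))

  ⊛-cong : ∀ m {f f′ g g′} → (∀ j → f j ≈ f′ j) → (∀ j → g j ≈ g′ j) →
           (f ⊛ g) m ≈ (f′ ⊛ g′) m
  ⊛-cong m f≈f′ g≈g′ = ⊛-cong-≤ m (λ {j} _ → f≈f′ j) (λ {j} _ → g≈g′ j)

  ⊛-distribʳ-+ : ∀ f f′ g n → ((λ i → f i + f′ i) ⊛ g) n ≈ (f ⊛ g) n + (f′ ⊛ g) n
  ⊛-distribʳ-+ f f′ g n =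
    trans (∑-cong (upTo (suc n)) (λ i → distribʳ (g (n ∸ i)) (f i) (f′ i))) (∑-+ (upTo (suc n)) _ _)

  ⊛-neg : ∀ f g n → ((λ i → - f i) ⊛ g) n ≈ - (f ⊛ g) n
  ⊛-neg f g n =
    trans (∑-cong (upTo (suc n)) (λ i → sym (-‿distribˡ-* (f i) (g (n ∸ i)))))
          (∑-neg (upTo (suc n)) _)

  ⊛-distribʳ-- : ∀ f f′ g n → ((f ⊝ f′) ⊛ g) n ≈ (f ⊛ g) n - (f′ ⊛ g) n
  ⊛-distribʳ-- f f′ g n = trans (⊛-distribʳ-+ f (λ i → - f′ i) g n) (+-congˡ (⊛-neg f′ g n))

  ⊛-*ˡ : ∀ a f g n → ((λ i → a * f i) ⊛ g) n ≈ a * (f ⊛ g) n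
  ⊛-*ˡ a f g n =
    trans (∑-cong (upTo (suc n)) (λ i → *-assoc a (f i) (g (n ∸ i)))) (∑-*ˡ (upTo (suc n)) a _)

  ⊛-*ʳ : ∀ a f g n → (f ⊛ (λ i → g i * a)) n ≈ (f ⊛ g) n * a
  ⊛-*ʳ a f g n =
    trans (∑-cong (upTo (suc n)) (λ i → sym (*-assoc (f i) (g (n ∸ i)) a)))
          (∑-*ʳ (upTo (suc n)) a _)

  ⊛-× : ∀ k f g n → (f ⊛ (λ i → k × g i)) n ≈ k × (f ⊛ g) n
  ⊛-× k f g n =
    trans (∑-cong (upTo (suc n)) (λ i → ×-comm-* k (f i) (g (n ∸ i)))) (∑-× (upTo (suc n)) k _)

  ⊛-∑ : ∀ {X : Set} xs f (g : X → PS) n →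
        (f ⊛ (λ j → ∑[ x ← xs ] g x j)) n ≈ ∑[ x ← xs ] (f ⊛ g x) n
  ⊛-∑ xs f g n = begin
    ∑[ i ← upTo (suc n) ] (f i * ∑[ x ← xs ] g x (n ∸ i))
      ≈⟨ ∑-cong (upTo (suc n)) (λ i → sym (∑-*ˡ xs (f i) (λ x → g x (n ∸ i)))) ⟩
    ∑[ i ← upTo (suc n) ] ∑[ x ← xs ] (f i * g x (n ∸ i))
      ≈⟨ ∑-comm (upTo (suc n)) xs (λ i x → f i * g x (n ∸ i)) ⟩
    ∑[ x ← xs ] (f ⊛ g x) n ∎

  const-⊛ : ∀ a g n → (const a ⊛ g) n ≈ a * g n
  const-⊛ a g zero    = ⊛-zero (const a) g
  const-⊛ a g (suc n) = begin
    (const a ⊛ g) (suc n)                      ≡⟨ ⊛-suc (const a) g n ⟩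
    a * g (suc n) + ((const a ∘ suc) ⊛ g) n    ≈⟨ +-congˡ (∑-zero (upTo (suc n)) (λ _ → zeroˡ _)) ⟩
    a * g (suc n) + 0#                         ≈⟨ +-identityʳ _ ⟩
    a * g (suc n)                              ∎

  ⊛-const : ∀ f a n → (f ⊛ const a) n ≈ f n * a
  ⊛-const f a zero    = ⊛-zero f (const a)
  ⊛-const f a (suc n) = begin
    (f ⊛ const a) (suc n)                    ≡⟨ ⊛-suc f (const a) n ⟩
    f 0 * 0# + ((f ∘ suc) ⊛ const a) n       ≈⟨ +-cong (zeroʳ _) (⊛-const (f ∘ suc) a n) ⟩
    0# + f (suc n) * a                       ≈⟨ +-identityˡ _ ⟩
    f (suc n) * a                            ∎

  shift-⊛ : ∀ f g n → (shift f ⊛ g) n ≈ shift (f ⊛ g) n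
  shift-⊛ f g zero    = trans (⊛-zero (shift f) g) (zeroˡ _)
  shift-⊛ f g (suc n) = begin
    (shift f ⊛ g) (suc n)       ≡⟨ ⊛-suc (shift f) g n ⟩
    0# * g (suc n) + (f ⊛ g) n  ≈⟨ +-congʳ (zeroˡ _) ⟩
    0# + (f ⊛ g) n              ≈⟨ +-identityˡ _ ⟩
    (f ⊛ g) n                   ∎

  ⊛-shift : ∀ f g n → (f ⊛ shift g) n ≈ shift (f ⊛ g) n
  ⊛-shift f g zero          = trans (⊛-zero f (shift g)) (zeroʳ _)
  ⊛-shift f g (suc zero)    = begin
    (f ⊛ shift g) 1                          ≡⟨ ⊛-suc f (shift g) 0 ⟩
    f 0 * g 0 + ((f ∘ suc) ⊛ shift g) 0      ≈⟨ +-congˡ (⊛-shift (f ∘ suc) g 0) ⟩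
    (f ⊛ g) 0                                ∎
  ⊛-shift f g (suc (suc n)) = begin
    (f ⊛ shift g) (suc (suc n))                      ≡⟨ ⊛-suc f (shift g) (suc n) ⟩
    f 0 * g (suc n) + ((f ∘ suc) ⊛ shift g) (suc n)  ≈⟨ +-congˡ (⊛-shift (f ∘ suc) g (suc n)) ⟩
    f 0 * g (suc n) + ((f ∘ suc) ⊛ g) n              ≡⟨ ≡.sym (⊛-suc f g n) ⟩
    (f ⊛ g) (suc n)                                  ∎

  ⊛-Z : ∀ f n → (f ⊛ Z) n ≈ shift f n
  ⊛-Z f zero    = trans (⊛-zero f Z) (zeroʳ _)
  ⊛-Z f (suc n) = begin
    (f ⊛ Z) (suc n)                 ≈⟨ ⊛-cong (suc n) (λ _ → refl) Z≗shift-1 ⟩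
    (f ⊛ shift (const 1#)) (suc n)  ≈⟨ ⊛-shift f (const 1#) (suc n) ⟩
    (f ⊛ const 1#) n                ≈⟨ ⊛-const f 1# n ⟩
    f n * 1#                        ≈⟨ *-identityʳ _ ⟩
    f n                             ∎
    where
    Z≗shift-1 : ∀ j → Z j ≈ shift (const 1#) j
    Z≗shift-1 zero          = refl
    Z≗shift-1 (suc zero)    = refl
    Z≗shift-1 (suc (suc j)) = refl

  ⊛-assoc : ∀ f g h n → ((f ⊛ g) ⊛ h) n ≈ (f ⊛ (g ⊛ h)) n
  ⊛-assoc f g h zero = begin
    ((f ⊛ g) ⊛ h) 0    ≈⟨ trans (⊛-zero (f ⊛ g) h) (*-congʳ (⊛-zero f g)) ⟩
    (f 0 * g 0) * h 0  ≈⟨ *-assoc _ _ _ ⟩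
    f 0 * (g 0 * h 0)  ≈⟨ sym (trans (⊛-zero f (g ⊛ h)) (*-congˡ (⊛-zero g h))) ⟩
    (f ⊛ (g ⊛ h)) 0    ∎
  ⊛-assoc f g h (suc n) = begin
    ((f ⊛ g) ⊛ h) (suc n)
      ≡⟨ ⊛-suc (f ⊛ g) h n ⟩
    (f ⊛ g) 0 * h (suc n) + (((f ⊛ g) ∘ suc) ⊛ h) n
      ≈⟨ +-cong (*-congʳ (⊛-zero f g))
                (⊛-cong n {g = h} (λ j → reflexive (⊛-suc f g j)) (λ _ → refl)) ⟩
    (f 0 * g 0) * h (suc n) + ((λ j → f 0 * g (suc j) + ((f ∘ suc) ⊛ g) j) ⊛ h) n
      ≈⟨ +-congˡ (⊛-distribʳ-+ (λ j → f 0 * g (suc j)) ((f ∘ suc) ⊛ g) h n) ⟩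
    (f 0 * g 0) * h (suc n) + (((λ j → f 0 * g (suc j)) ⊛ h) n + (((f ∘ suc) ⊛ g) ⊛ h) n)
      ≈⟨ +-congˡ (+-cong (⊛-*ˡ (f 0) (g ∘ suc) h n) (⊛-assoc (f ∘ suc) g h n)) ⟩
    (f 0 * g 0) * h (suc n) + (f 0 * ((g ∘ suc) ⊛ h) n + ((f ∘ suc) ⊛ (g ⊛ h)) n)
      ≈⟨ sym (+-assoc _ _ _) ⟩
    ((f 0 * g 0) * h (suc n) + f 0 * ((g ∘ suc) ⊛ h) n) + ((f ∘ suc) ⊛ (g ⊛ h)) n
      ≈⟨ +-congʳ (trans (+-congʳ (*-assoc _ _ _)) (sym (distribˡ _ _ _))) ⟩
    f 0 * (g 0 * h (suc n) + ((g ∘ suc) ⊛ h) n) + ((f ∘ suc) ⊛ (g ⊛ h)) n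
      ≡⟨ ≡.cong (λ t → f 0 * t + ((f ∘ suc) ⊛ (g ⊛ h)) n) (≡.sym (⊛-suc g h n)) ⟩
    f 0 * (g ⊛ h) (suc n) + ((f ∘ suc) ⊛ (g ⊛ h)) n
      ≡⟨ ≡.sym (⊛-suc f (g ⊛ h) n) ⟩
    (f ⊛ (g ⊛ h)) (suc n) ∎

  ⊛-linear : ∀ a b c f g F n →
    ((λ i → const a i + (b * f i + c * g i)) ⊛ F) n ≈ a * F n + (b * (f ⊛ F) n + c * (g ⊛ F) n)
  ⊛-linear a b c f g F n =
    trans (⊛-distribʳ-+ (const a) _ F n)
          (+-cong (const-⊛ a F n)
                  (trans (⊛-distribʳ-+ _ _ F n) (+-cong (⊛-*ˡ b f F n) (⊛-*ˡ c g F n))))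

  -- Walk sums and the first-step equations

  ∑-allSteps-suc : ∀ l (F : List Step → Carrier) →
    ∑ (allSteps (suc l)) F ≈ ∑[ ss ← allSteps l ] (F (down ∷ ss) + (F (flat ∷ ss) + F (up ∷ ss)))
  ∑-allSteps-suc l F = begin
    Σ (map F (concatMap branch (allSteps l)))    ≡⟨ ≡.cong Σ (map-concatMap F branch (allSteps l)) ⟩
    Σ (concatMap (map F ∘ branch) (allSteps l))  ≈⟨ Σ-concatMap (allSteps l) (map F ∘ branch) ⟩
    ∑[ ss ← allSteps l ] Σ (map F (branch ss))
      ≈⟨ ∑-cong (allSteps l) (λ ss → +-congˡ (+-congˡ (+-identityʳ _))) ⟩
    ∑[ ss ← allSteps l ] (F (down ∷ ss) + (F (flat ∷ ss) + F (up ∷ ss))) ∎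
    where
    branch : List Step → List (List Step)
    branch ss = (down ∷ ss) ∷ (flat ∷ ss) ∷ (up ∷ ss) ∷ []

  walkSum : (ℤ → List Step → Carrier) → ℤ → PS
  walkSum wt a l = ∑[ ss ← allSteps l ] (if stdTo0 a ss then wt a ss else 0#)

  record FirstStepFamily (T : ℕ → PS) : Set ℓ where
    field
      step  : ∀ h n → T (suc h) (suc n) ≈ A * T h n + (B * T (suc h) n + C * T (suc (suc h)) n)
      empty : ∀ h → T (suc h) 0 ≈ 0#

  firstStepFamily-short : ∀ {T} → FirstStepFamily T → ∀ {n h} → n ≤ h → T (suc h) n ≈ 0#
  firstStepFamily-short         family {zero}          _         = FirstStepFamily.empty family _
  firstStepFamily-short {T = T} family {suc n} {suc h} (s≤s n≤h) = begin
    T (suc (suc h)) (suc n)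
      ≈⟨ step (suc h) n ⟩
    A * T (suc h) n + (B * T (suc (suc h)) n + C * T (suc (suc (suc h))) n)
      ≈⟨ +-cong (x≈0⇒y*x≈0 (short n≤h))
                (+-cong (x≈0⇒y*x≈0 (short (ℕ.m≤n⇒m≤1+n n≤h)))
                        (x≈0⇒y*x≈0 (short (ℕ.m≤n⇒m≤1+n (ℕ.m≤n⇒m≤1+n n≤h))))) ⟩
    0# + (0# + 0#)
      ≈⟨ trans (+-identityˡ _) (+-identityˡ 0#) ⟩
    0# ∎
    where
    open FirstStepFamily family
    short : ∀ {m k} → m ≤ k → T (suc k) m ≈ 0#
    short = firstStepFamily-short family

  module WalkSum (wt : ℤ → List Step → Carrier) (V : ℤ → Step → Carrier)
                 (wt-∷ : ∀ a s ss → wt a (s ∷ ss) ≡ V a s * wt (a ℤ.+ δ s) ss) where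

    walkSum-suc : ∀ h n → walkSum wt (pos h) (suc n) ≈
      V (pos h) down * walkSum wt (pos h ℤ.+ δ down) n +
      (V (pos h) flat * walkSum wt (pos h ℤ.+ δ flat) n +
       V (pos h) up * walkSum wt (pos h ℤ.+ δ up) n)
    walkSum-suc h n = begin
      walkSum wt (pos h) (suc n)
        ≈⟨ ∑-allSteps-suc n (summand (pos h)) ⟩
      ∑[ ss ← allSteps n ] (summand (pos h) (down ∷ ss) +
                            (summand (pos h) (flat ∷ ss) + summand (pos h) (up ∷ ss)))
        ≈⟨ ∑-cong (allSteps n) (λ ss → +-cong (first-step down ss)
                                               (+-cong (first-step flat ss) (first-step up ss))) ⟩
      ∑[ ss ← allSteps n ] (V′ down * after down ss +
                            (V′ flat * after flat ss + V′ up * after up ss))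
        ≈⟨ trans (∑-+ (allSteps n) _ _) (+-congˡ (∑-+ (allSteps n) _ _)) ⟩
      ∑[ ss ← allSteps n ] (V′ down * after down ss) +
      (∑[ ss ← allSteps n ] (V′ flat * after flat ss) + ∑[ ss ← allSteps n ] (V′ up * after up ss))
        ≈⟨ +-cong (∑-*ˡ (allSteps n) _ _) (+-cong (∑-*ˡ (allSteps n) _ _) (∑-*ˡ (allSteps n) _ _)) ⟩
      V′ down * walkSum wt (pos h ℤ.+ δ down) n +
      (V′ flat * walkSum wt (pos h ℤ.+ δ flat) n + V′ up * walkSum wt (pos h ℤ.+ δ up) n) ∎
      where
      summand : ℤ → List Step → Carrier
      summand a ss = if stdTo0 a ss then wt a ss else 0#
      V′ : Step → Carrier
      V′ = V (pos h)
      after : Step → List Step → Carrier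
      after s = summand (pos h ℤ.+ δ s)
      first-step : ∀ s ss → summand (pos h) (s ∷ ss) ≈ V′ s * after s ss
      first-step s ss rewrite stdTo0-∷ h s ss | wt-∷ (pos h) s ss with stdTo0 (pos h ℤ.+ δ s) ss
      ... | true  = refl
      ... | false = sym (zeroʳ _)

    walkSum-negative : ∀ k n → walkSum wt -[1+ k ] n ≈ 0#
    walkSum-negative k n = ∑-zero (allSteps n) vanishes
      where
      vanishes : ∀ {ss} → ss ∈ allSteps n →
                 (if stdTo0 -[1+ k ] ss then wt -[1+ k ] ss else 0#) ≈ 0#
      vanishes {ss} _ rewrite stdTo0-negative k ss = refl

    walkSum-firstStepFamily : (∀ h s → V (pos (suc h)) s ≡ U s) →
                              FirstStepFamily (λ h → walkSum wt (pos h))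
    walkSum-firstStepFamily V≡U = record { step = step ; empty = empty }
      where
      step : ∀ h n → walkSum wt (pos (suc h)) (suc n) ≈
        A * walkSum wt (pos h) n +
        (B * walkSum wt (pos (suc h)) n + C * walkSum wt (pos (suc (suc h))) n)
      step h n = trans (walkSum-suc (suc h) n)
        (+-cong (*-congʳ (reflexive (V≡U h down)))
                (+-cong (*-cong (reflexive (V≡U h flat)) (same-start (ℤ.+-identityʳ (pos (suc h)))))
                        (*-cong (reflexive (V≡U h up))
                                (same-start (≡.cong pos (ℕ.+-comm (suc h) 1))))))
        where
        same-start : ∀ {a b} → a ≡ b → walkSum wt a n ≈ walkSum wt b n
        same-start a≡b = reflexive (≡.cong (λ a → walkSum wt a n) a≡b)
      empty : ∀ h → walkSum wt (pos (suc h)) 0 ≈ 0#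
      empty h rewrite stdTo0-suc-[] h = +-identityʳ 0#

  module Plain   = WalkSum (λ _ → w) (λ _ → U) (λ _ _ _ → ≡.refl)
  module Starred = WalkSum w* U* (λ _ _ _ → ≡.refl)

  walksFrom walksFrom* : ℕ → PS
  walksFrom  h = walkSum (λ _ → w) (pos h)
  walksFrom* h = walkSum w* (pos h)

  walksFrom-firstStepFamily : FirstStepFamily walksFrom
  walksFrom-firstStepFamily = Plain.walkSum-firstStepFamily (λ _ _ → ≡.refl)

  walksFrom*-firstStepFamily : FirstStepFamily walksFrom*
  walksFrom*-firstStepFamily = Starred.walkSum-firstStepFamily U*≡U
    where
    U*≡U : ∀ h s → U* (pos (suc h)) s ≡ U s
    U*≡U h down = ≡.refl
    U*≡U h flat = ≡.refl
    U*≡U h up   = ≡.refl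

  G-zero : G 0 ≈ 1#
  G-zero = +-identityʳ 1#

  G-suc : ∀ n → G (suc n) ≈ B * G n + C * walksFrom 1 n
  G-suc n = begin
    G (suc n)
      ≈⟨ Plain.walkSum-suc 0 n ⟩
    A * walkSum (λ _ → w) -[1+ 0 ] n + (B * G n + C * walksFrom 1 n)
      ≈⟨ +-congʳ (x≈0⇒y*x≈0 (Plain.walkSum-negative 0 n)) ⟩
    0# + (B * G n + C * walksFrom 1 n)
      ≈⟨ +-identityˡ _ ⟩
    B * G n + C * walksFrom 1 n ∎

  -- First passage

  Q X : PS
  Q n = G n * A
  X   = (G ⊛ const A) ⊛ Z

  X≈shift-Q : ∀ n → X n ≈ shift Q n
  X≈shift-Q zero    = ⊛-Z (G ⊛ const A) 0
  X≈shift-Q (suc n) = trans (⊛-Z (G ⊛ const A) (suc n)) (⊛-const G A n)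

  X-⊛ : ∀ F n → (X ⊛ F) n ≈ shift (Q ⊛ F) n
  X-⊛ F n = trans (⊛-cong n {g = F} X≈shift-Q (λ _ → refl)) (shift-⊛ Q F n)

  Q-unfold : ∀ n → (∀ {m} → m < n → walksFrom 1 m ≈ (X ⊛ G) m) →
             Q n ≈ const A n + (B * X n + C * (X ⊛ X) n)
  Q-unfold zero _ = begin
    G 0 * A                        ≈⟨ trans (*-congʳ G-zero) (*-identityˡ A) ⟩
    A                              ≈⟨ sym (+-identityʳ A) ⟩
    A + 0#                         ≈⟨ +-congˡ (sym (+-identityʳ 0#)) ⟩
    A + (0# + 0#)                  ≈⟨ +-congˡ (sym (+-cong (x≈0⇒y*x≈0 (X≈shift-Q 0))
                                                           (x≈0⇒y*x≈0 (X-⊛ X 0)))) ⟩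
    A + (B * X 0 + C * (X ⊛ X) 0)  ∎
  Q-unfold (suc m) passage = begin
    G (suc m) * A
      ≈⟨ *-congʳ (G-suc m) ⟩
    (B * G m + C * walksFrom 1 m) * A
      ≈⟨ trans (distribʳ A _ _) (+-cong (*-assoc B (G m) A) (*-assoc C _ A)) ⟩
    B * Q m + C * (walksFrom 1 m * A)
      ≈⟨ +-congˡ (*-congˡ (*-congʳ (passage ℕ.≤-refl))) ⟩
    B * Q m + C * ((X ⊛ G) m * A)
      ≈⟨ +-congˡ (*-congˡ (sym (⊛-*ʳ A X G m))) ⟩
    B * Q m + C * (X ⊛ Q) m
      ≈⟨ sym (+-cong (*-congˡ (X≈shift-Q (suc m))) (*-congˡ XX≈XQ)) ⟩
    B * X (suc m) + C * (X ⊛ X) (suc m)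
      ≈⟨ sym (+-identityˡ _) ⟩
    0# + (B * X (suc m) + C * (X ⊛ X) (suc m)) ∎
    where
    XX≈XQ : (X ⊛ X) (suc m) ≈ (X ⊛ Q) m
    XX≈XQ = trans (⊛-cong (suc m) {f = X} (λ _ → refl) X≈shift-Q) (⊛-shift X Q (suc m))

  FirstPassage : ℕ → Set (c ⊔ ℓ)
  FirstPassage n = ∀ T → FirstStepFamily T → ∀ h → T (suc h) n ≈ (X ⊛ T h) n

  firstPassage-zero : FirstPassage 0
  firstPassage-zero T family h = trans (FirstStepFamily.empty family h) (sym (X-⊛ (T h) 0))

  firstPassage-suc : ∀ n → (∀ {m} → m < suc n → FirstPassage m) → FirstPassage (suc n)
  firstPassage-suc n passage T family h = begin
    T (suc h) (suc n)
      ≈⟨ FirstStepFamily.step family h n ⟩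
    A * T h n + (B * T (suc h) n + C * T (suc (suc h)) n)
      ≈⟨ +-congˡ (+-cong (*-congˡ (passage ℕ.≤-refl T family h)) (*-congˡ two-levels)) ⟩
    A * T h n + (B * (X ⊛ T h) n + C * ((X ⊛ X) ⊛ T h) n)
      ≈⟨ sym (⊛-linear A B C X (X ⊛ X) (T h) n) ⟩
    ((λ i → const A i + (B * X i + C * (X ⊛ X) i)) ⊛ T h) n
      ≈⟨ ⊛-cong-≤ n {g = T h} (λ {j} j≤n → sym (Q-unfold j (plain-passage j≤n))) (λ _ → refl) ⟩
    (Q ⊛ T h) n
      ≈⟨ sym (X-⊛ (T h) (suc n)) ⟩
    (X ⊛ T h) (suc n) ∎
    where
    plain-passage : ∀ {j m} → j ≤ n → m < j → walksFrom 1 m ≈ (X ⊛ G) m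
    plain-passage j≤n m<j =
      passage (ℕ.<-≤-trans m<j (ℕ.m≤n⇒m≤1+n j≤n)) walksFrom walksFrom-firstStepFamily 0
    two-levels : T (suc (suc h)) n ≈ ((X ⊛ X) ⊛ T h) n
    two-levels = begin
      T (suc (suc h)) n  ≈⟨ passage ℕ.≤-refl T family (suc h) ⟩
      (X ⊛ T (suc h)) n  ≈⟨ ⊛-cong-≤ n {f = X} (λ _ → refl) (λ j≤n → passage (s≤s j≤n) T family h) ⟩
      (X ⊛ (X ⊛ T h)) n  ≈⟨ sym (⊛-assoc X X (T h) n) ⟩
      ((X ⊛ X) ⊛ T h) n  ∎

  firstPassage : ∀ T → FirstStepFamily T → ∀ h n → T (suc h) n ≈ (X ⊛ T h) n
  firstPassage T family h n = <-rec FirstPassage passage n T family h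
    where
    passage : ∀ n → (∀ {m} → m < n → FirstPassage m) → FirstPassage n
    passage zero    _   = firstPassage-zero
    passage (suc n) hyp = firstPassage-suc n hyp

  -- The generating functions G*_r

  G*≈∑walksFrom* : ∀ r l → G* r l ≈ ∑[ h ← upTo (suc l) ] (binom h r × walksFrom* h l)
  G*≈∑walksFrom* r l = begin
    G* r l
      ≈⟨ Σ-concatMap (starts l) (λ a → map (summand a) (allSteps l)) ⟩
    ∑[ a ← starts l ] ∑[ ss ← allSteps l ] summand a ss
      ≈⟨ ∑-cong (starts l) (λ a → trans (∑-cong (allSteps l) (·-if a))
                                        (∑-× (allSteps l) (binomℤ a r) _)) ⟩
    ∑[ a ← starts l ] weighted a
      ≡⟨ ≡.cong Σ (map-∘ (upTo (suc (2 ℕ.* l)))) ⟨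
    ∑[ k ← upTo (suc (2 ℕ.* l)) ] weighted (pos k ℤ.- pos l)
      ≡⟨ ≡.cong (λ n → ∑[ k ← upTo n ] weighted (pos k ℤ.- pos l)) suc[2l]≡l+suc[l] ⟩
    ∑[ k ← upTo (l ℕ.+ suc l) ] weighted (pos k ℤ.- pos l)
      ≈⟨ ∑-upTo-+ l (suc l) _ ⟩
    ∑[ k ← upTo l ] weighted (pos k ℤ.- pos l) +
    ∑[ h ← upTo (suc l) ] weighted (pos (l ℕ.+ h) ℤ.- pos l)
      ≈⟨ +-cong (∑-zero (upTo l) negative-start)
                (∑-cong (upTo (suc l)) (λ h → reflexive (≡.cong weighted (pos[m+n]-pos-m l h)))) ⟩
    0# + ∑[ h ← upTo (suc l) ] (binom h r × walksFrom* h l)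
      ≈⟨ +-identityˡ _ ⟩
    ∑[ h ← upTo (suc l) ] (binom h r × walksFrom* h l) ∎
    where
    summand : ℤ → List Step → Carrier
    summand a ss = if stdTo0 a ss then binomℤ a r · w* a ss else 0#
    weighted : ℤ → Carrier
    weighted a = binomℤ a r × walkSum w* a l
    ·-if : ∀ a ss → summand a ss ≈ binomℤ a r × (if stdTo0 a ss then w* a ss else 0#)
    ·-if a ss with stdTo0 a ss
    ... | true  = reflexive (·≡× (binomℤ a r) (w* a ss))
    ... | false = sym (×-zeroʳ (binomℤ a r))
    suc[2l]≡l+suc[l] : suc (2 ℕ.* l) ≡ l ℕ.+ suc l
    suc[2l]≡l+suc[l] =
      ≡.trans (≡.cong (λ m → suc (l ℕ.+ m)) (ℕ.+-identityʳ l)) (≡.sym (ℕ.+-suc l l))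
    -- binomℤ is 0 at negative arguments, so negative starts contribute nothing.
    negative-start : ∀ {k} → k ∈ upTo l → weighted (pos k ℤ.- pos l) ≈ 0#
    negative-start k∈ rewrite pos-pos-negative (∈-upTo⁻ k∈) = refl

  G*-expansion : ∀ r {l N} → l < N → G* r l ≈ ∑[ h ← upTo N ] (binom h r × walksFrom* h l)
  G*-expansion r {l} l<N = trans (G*≈∑walksFrom* r l) (∑-upTo-extend _ l<N too-high)
    where
    too-high : ∀ i → binom (suc (l ℕ.+ i)) r × walksFrom* (suc (l ℕ.+ i)) l ≈ 0#
    too-high i = trans (×-congʳ (binom (suc (l ℕ.+ i)) r)
                                (firstStepFamily-short walksFrom*-firstStepFamily (ℕ.m≤m+n l i)))
                       (×-zeroʳ (binom (suc (l ℕ.+ i)) r))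

  X⊛G* : ∀ r n → (X ⊛ G* r) n ≈ ∑[ h ← upTo (suc n) ] (binom h r × walksFrom* (suc h) n)
  X⊛G* r n = begin
    (X ⊛ G* r) n
      ≈⟨ ⊛-cong-≤ n {f = X} (λ _ → refl) (λ j≤n → G*-expansion r (s≤s j≤n)) ⟩
    (X ⊛ (λ j → ∑[ h ← upTo (suc n) ] (binom h r × walksFrom* h j))) n
      ≈⟨ ⊛-∑ (upTo (suc n)) X (λ h j → binom h r × walksFrom* h j) n ⟩
    ∑[ h ← upTo (suc n) ] (X ⊛ (λ j → binom h r × walksFrom* h j)) n
      ≈⟨ ∑-cong (upTo (suc n)) (λ h → ⊛-× (binom h r) X (walksFrom* h) n) ⟩
    ∑[ h ← upTo (suc n) ] (binom h r × (X ⊛ walksFrom* h) n)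
      ≈⟨ ∑-cong (upTo (suc n)) (λ h → ×-congʳ (binom h r) (sym (passage h))) ⟩
    ∑[ h ← upTo (suc n) ] (binom h r × walksFrom* (suc h) n) ∎
    where
    passage : ∀ h → walksFrom* (suc h) n ≈ (X ⊛ walksFrom* h) n
    passage h = firstPassage walksFrom* walksFrom*-firstStepFamily h n

  G*-recurrence : ∀ r n → G* (suc r) n ≈ (X ⊛ G* (suc r)) n + (X ⊛ G* r) n
  G*-recurrence r n = begin
    G* (suc r) n
      ≈⟨ G*-expansion (suc r) (ℕ.m<n⇒m<1+n (ℕ.n<1+n n)) ⟩
    ∑[ h ← upTo (suc (suc n)) ] term (binom h (suc r)) h
      -- the h = 0 term binom 0 (suc r) × walksFrom* 0 n computes to 0#
      ≡⟨ ∑-upTo-suc (suc n) (λ h → term (binom h (suc r)) h) ⟩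
    0# + ∑[ h ← upTo (suc n) ] term (binom (suc h) (suc r)) (suc h)
      ≈⟨ +-identityˡ _ ⟩
    ∑[ h ← upTo (suc n) ] term (binom (suc h) (suc r)) (suc h)
      ≈⟨ ∑-cong (upTo (suc n)) pascal ⟩
    ∑[ h ← upTo (suc n) ] (term (binom h (suc r)) (suc h) + term (binom h r) (suc h))
      ≈⟨ ∑-+ (upTo (suc n)) _ _ ⟩
    ∑[ h ← upTo (suc n) ] term (binom h (suc r)) (suc h) +
    ∑[ h ← upTo (suc n) ] term (binom h r) (suc h)
      ≈⟨ sym (+-cong (X⊛G* (suc r) n) (X⊛G* r n)) ⟩
    (X ⊛ G* (suc r)) n + (X ⊛ G* r) n ∎
    where
    term : ℕ → ℕ → Carrier
    term k h = k × walksFrom* h n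
    pascal : ∀ h → term (binom (suc h) (suc r)) (suc h) ≈
                   term (binom h (suc r)) (suc h) + term (binom h r) (suc h)
    pascal h = begin
      binom (suc h) (suc r) × walksFrom* (suc h) n
        ≡⟨ ≡.cong (_× walksFrom* (suc h) n) (nCk+nC[k+1]≡[n+1]C[k+1] h r) ⟨
      (binom h r ℕ.+ binom h (suc r)) × walksFrom* (suc h) n
        ≈⟨ ×-homo-+ _ (binom h r) (binom h (suc r)) ⟩
      term (binom h r) (suc h) + term (binom h (suc r)) (suc h)
        ≈⟨ +-comm _ _ ⟩
      term (binom h (suc r)) (suc h) + term (binom h r) (suc h) ∎

lemma5p7 : ∀ {c ℓ} (Λ : Ring c ℓ) (A B C D : Ring.Carrier Λ) (r : ℕ) →
    let open Walks Λ A B C D in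
    ((const (Ring.1# Λ) ⊝ ((G ⊛ const A) ⊛ Z)) ⊛ G* (suc r)) ≋ ((G ⊛ (const A ⊛ Z)) ⊛ G* r)
lemma5p7 Λ A B C D r n = begin
  ((const 1# ⊝ X) ⊛ G* (suc r)) n
    ≈⟨ ⊛-distribʳ-- (const 1#) X (G* (suc r)) n ⟩
  (const 1# ⊛ G* (suc r)) n - (X ⊛ G* (suc r)) n
    ≈⟨ +-congʳ (trans (const-⊛ 1# (G* (suc r)) n) (*-identityˡ _)) ⟩
  G* (suc r) n - (X ⊛ G* (suc r)) n
    ≈⟨ +-congʳ (G*-recurrence r n) ⟩
  ((X ⊛ G* (suc r)) n + (X ⊛ G* r) n) - (X ⊛ G* (suc r)) n
    ≈⟨ xyx⁻¹≈y _ _ ⟩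
  (X ⊛ G* r) n
    ≈⟨ ⊛-cong n {g = G* r} (λ i → ⊛-assoc G (const A) Z i) (λ _ → refl) ⟩
  ((G ⊛ (const A ⊛ Z)) ⊛ G* r) n ∎
  where
  open Ring Λ
  open Walks Λ A B C D
  open WalkSeries Λ A B C D
  open import Algebra.Properties.AbelianGroup +-abelianGroup using (xyx⁻¹≈y)
  open import Relation.Binary.Reasoning.Setoid setoid
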